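{- For every $n\in\mathbb N$, the map $(x,y,z,w)\mapsto(-2w-1,\,2x,\,-2z-1,\,2y)$ restricts to a bijection $SC_{9,2n}\to SC_{9,8n+10}$.
   Context: $\mathbb N=\{0,1,2,\ldots\}$. A partition $\lambda$ is determined by its arm set $A^+(\lambda)=\{\lambda_i-i:1\le i\le s\}$ and leg set $L^+(\lambda)=\{\lambda^*_i-i:1\le i\le s\}$ ($s=\#\{i:\lambda_i\ge i\}$, $\lambda^*$ the conjugate); any two finite subsets of $\mathbb N$ of equal size are the leg and arm sets of a unique partition. For $c=(c_0,\ldots,c_{t-1})\in\mathbb Z^t$ with coordinate sum $0$, $\lambda_c$ is the partition with arm set $\{qt+j:0\le q<c_j\}$ and leg set $\{qt+t-j-1:0\le q<-c_j\}$. $SC_{t,n}$ is the set of such $c$ with $|\lambda_c|=n$ and $\lambda_c^*=\lambda_c$. For $t=9$, a tuple $(x,y,z,w)\in\mathbb Z^4$ is identified with $(-w,-z,-y,-x,0,x,y,z,w)\in\mathbb Z^9$, and $SC_{9,n}$ is regarded as a set of such tuples. -}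

module Defs where

open import Data.Nat using (ℕ; zero; suc; _+_; _*_; _∸_; _≤?_)
open import Data.Nat.Properties using (≤-decTotalOrder)
open import Data.Integer using (ℤ; +_; -[1+_]; -_) renaming (_+_ to _+ℤ_; _*_ to _*ℤ_)
open import Data.List using (List; []; _∷_; _++_; map; length; filter; upTo; zipWith; reverse; concat)
open import Data.Product using (_×_; _,_)
open import Data.Nat.ListAction using (sum)
open import Relation.Binary.PropositionalEquality using (_≡_)
open import Data.List.Sort.InsertionSort ≤-decTotalOrder using (sort)

-- A tuple (x,y,z,w) ∈ ℤ⁴, identified with the 9-tuple
-- c = (-w,-z,-y,-x,0,x,y,z,w) (coordinate sum automatically 0).
record Tuple4 : Set where
  constructor ⟨_,_,_,_⟩
  field
    x y z w : ℤ

nine : Tuple4 → List ℤ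
nine ⟨ x , y , z , w ⟩ = (- w) ∷ (- z) ∷ (- y) ∷ (- x) ∷ (+ 0) ∷ x ∷ y ∷ z ∷ w ∷ []

indexed : List ℤ → List (ℕ × ℤ)
indexed cs = zipWith _,_ (upTo (length cs)) cs

armsAt : ℕ × ℤ → List ℕ
armsAt (j , + k)     = map (λ q → q * 9 + j) (upTo k)
armsAt (j , -[1+ k ]) = []

legsAt : ℕ × ℤ → List ℕ
legsAt (j , + k)     = []
legsAt (j , -[1+ k ]) = map (λ q → q * 9 + (9 ∸ j ∸ 1)) (upTo (suc k))

armSet : Tuple4 → List ℕ
armSet t = concat (map armsAt (indexed (nine t)))

legSet : Tuple4 → List ℕ
legSet t = concat (map legsAt (indexed (nine t)))

-- partitions are represented as lists of positive parts λ₁ ≥ λ₂ ≥ ...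
sortDesc : List ℕ → List ℕ
sortDesc xs = reverse (sort xs)

countGE : ℕ → List ℕ → ℕ
countGE i xs = length (filter (λ x → i ≤? x) xs)

oneTo : ℕ → List ℕ
oneTo n = map suc (upTo n)

belowDiagonal : ℕ → List ℕ → List ℕ → List ℕ
belowDiagonal s cols []       = []
belowDiagonal s cols (l₁ ∷ _) = map (λ k → countGE (suc (s + k)) cols) (upTo (suc l₁ ∸ s))

-- The unique partition with arm set A and leg set L (Frobenius coordinates),
-- given |A| = |L| = s.
fromArmsLegs : List ℕ → List ℕ → List ℕ
fromArmsLegs A L = top ++ bottom
  where
    a = sortDesc A
    l = sortDesc L
    s = length a
    top = zipWith (λ i ai → ai + i) (oneTo s) a
    colLens = zipWith (λ j lj → lj + j) (oneTo s) l
    bottom = belowDiagonal s colLens l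

partitionOf : Tuple4 → List ℕ
partitionOf t = fromArmsLegs (armSet t) (legSet t)

conjugate : List ℕ → List ℕ
conjugate []       = []
conjugate (p ∷ ps) = map (λ j → countGE j (p ∷ ps)) (oneTo p)

size : List ℕ → ℕ
size = sum

SC9 : ℕ → Tuple4 → Set
SC9 n t = (size (partitionOf t) ≡ n) × (conjugate (partitionOf t) ≡ partitionOf t)

φ : Tuple4 → Tuple4
φ ⟨ x , y , z , w ⟩ =
  ⟨ (- (+ 2 *ℤ w)) +ℤ (- (+ 1)) , + 2 *ℤ x , (- (+ 2 *ℤ z)) +ℤ (- (+ 1)) , + 2 *ℤ y ⟩

-- The 9-tuple c = (−w,−z,−y,−x,0,x,y,z,w) is antisymmetric, so the leg blocks of λ_c are its arm
-- blocks in reverse order: the leg set equals the arm set A.  A partition with Frobenius coordinates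
-- (A | A) is self-conjugate of size Σ_{a∈A} (2a + 1), and summing this block by block gives
-- |λ_c| = Q(x,y,z,w) = Σ_{h=1}^{4} (9 v_h² + 2h v_h) with (v_1,…,v_4) = (x,y,z,w).  Hence SC_{9,n} is
-- the level set Q = n, and the corollary becomes a statement about Q:  Q(φ t) = 4 Q(t) + 10, φ is
-- injective, and Q ≡ 2 (mod 8) forces x, z odd and y, w even (Q mod 8 only depends on the
-- coordinates mod 4, and the 256 residue classes are checked by computation), i.e. forces u ∈ im φ.

module Submission where

module FrobeniusCoordinates where

  open import Defs using (countGE; oneTo; belowDiagonal; conjugate; fromArmsLegs; sortDesc; size)
  open import Data.Nat
  open import Data.Nat.Properties
  open import Data.Nat.ListAction using (sum)
  open import Data.Nat.ListAction.Properties using (sum-++; sum-↭)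
  import Data.Nat.Tactic.RingSolver as ℕ-Solver
  open import Data.List using (List; []; _∷_; [_]; _++_; _∷ʳ_; map; length; filter; upTo; applyUpTo; zipWith; reverse)
  open import Data.List.Properties
    using (length-++; filter-++; filter-all; filter-none; filter-accept; filter-reject; length-filter;
           map-++; map-cong; map-cong-local; map-∘; map-applyUpTo; map-upTo; upTo-∷ʳ; ++-assoc; ++-identityʳ; unfold-reverse)
  open import Data.List.Relation.Unary.All as All using (All; []; _∷_)
  open import Data.List.Relation.Unary.All.Properties using (applyUpTo⁺₁; applyUpTo⁺₂; map⁺)
  open import Data.List.Relation.Unary.AllPairs as AllPairs using (AllPairs; []; _∷_)
  import Data.List.Relation.Unary.AllPairs.Properties as AllPairs
  open import Relation.Binary.PropositionalEquality hiding ([_])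
  open import Data.List.Relation.Unary.Unique.Propositional using (Unique)
  open import Data.List.Relation.Binary.Permutation.Propositional using (_↭_; ↭-sym; ↭-trans; ↭⇒↭ₛ)
  import Data.List.Relation.Binary.Permutation.Propositional.Properties as ↭
  open import Data.List.Relation.Binary.Permutation.Setoid.Properties (setoid ℕ) using (Unique-resp-↭)
  open import Data.List.Relation.Binary.Pointwise using (Pointwise-≡⇒≡)
  open import Data.List.Relation.Unary.Sorted.TotalOrder.Properties using (Sorted⇒AllPairs; ↗↭↗⇒≋)
  open import Data.List.Sort.InsertionSort ≤-decTotalOrder using (sort)
  open import Data.List.Sort.InsertionSort.Properties ≤-decTotalOrder using (sort-↗; sort-↭)
  open import Data.Product using (_×_; _,_; proj₁; proj₂)
  open import Function using (id; _∘_; flip)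
  open import Relation.Nullary using (¬_; yes; no; contradiction)
  open ≡-Reasoning

  map-upTo-cong : ∀ {f g : ℕ → ℕ} n → (∀ {i} → i < n → f i ≡ g i) → map f (upTo n) ≡ map g (upTo n)
  map-upTo-cong n f≡g = map-cong-local (applyUpTo⁺₁ id n f≡g)

  upTo-+ : ∀ m n → upTo (m + n) ≡ upTo m ++ map (m +_) (upTo n)
  upTo-+ m zero = trans (cong upTo (+-identityʳ m)) (sym (++-identityʳ (upTo m)))
  upTo-+ m (suc n) = begin
    upTo (m + suc n)                                 ≡⟨ cong upTo (+-suc m n) ⟩
    upTo (suc (m + n))                               ≡⟨ upTo-∷ʳ (m + n) ⟨
    upTo (m + n) ∷ʳ (m + n)                          ≡⟨ cong (_∷ʳ (m + n)) (upTo-+ m n) ⟩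
    (upTo m ++ map (m +_) (upTo n)) ++ [ m + n ]     ≡⟨ ++-assoc (upTo m) _ _ ⟩
    upTo m ++ (map (m +_) (upTo n) ++ [ m + n ])     ≡⟨ cong (upTo m ++_) (map-++ (m +_) (upTo n) [ n ]) ⟨
    upTo m ++ map (m +_) (upTo n ∷ʳ n)               ≡⟨ cong (λ ns → upTo m ++ map (m +_) ns) (upTo-∷ʳ n) ⟩
    upTo m ++ map (m +_) (upTo (suc n))              ∎

  +-interchange : ∀ a b c d → (a + b) + (c + d) ≡ (a + c) + (b + d)
  +-interchange = ℕ-Solver.solve-∀

  sum-map-+ : ∀ (f g : ℕ → ℕ) xs → sum (map (λ x → f x + g x) xs) ≡ sum (map f xs) + sum (map g xs)
  sum-map-+ f g [] = refl
  sum-map-+ f g (x ∷ xs) =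
    trans (cong (f x + g x +_) (sum-map-+ f g xs)) (+-interchange (f x) (g x) _ _)

  sum-map-0 : ∀ (xs : List ℕ) → sum (map (λ _ → 0) xs) ≡ 0
  sum-map-0 []       = refl
  sum-map-0 (_ ∷ xs) = sum-map-0 xs

  nth : List ℕ → ℕ → ℕ
  nth []       _       = 0
  nth (x ∷ xs) zero    = x
  nth (x ∷ xs) (suc i) = nth xs i

  All-nth : ∀ {P : ℕ → Set} {xs} → All P xs → ∀ {i} → i < length xs → P (nth xs i)
  All-nth (px ∷ _)   {zero}  _   = px
  All-nth (_  ∷ pxs) {suc i} i<n = All-nth pxs (s<s⁻¹ i<n)

  map-nth-upTo : ∀ xs → map (nth xs) (upTo (length xs)) ≡ xs
  map-nth-upTo []       = refl
  map-nth-upTo (x ∷ xs) = cong (x ∷_) (begin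
    map (nth (x ∷ xs)) (applyUpTo suc (length xs))   ≡⟨ map-applyUpTo suc (nth (x ∷ xs)) (length xs) ⟩
    applyUpTo (nth xs) (length xs)                   ≡⟨ map-upTo (nth xs) (length xs) ⟨
    map (nth xs) (upTo (length xs))                  ≡⟨ map-nth-upTo xs ⟩
    xs                                                ∎)

  countGE-++ : ∀ j xs ys → countGE j (xs ++ ys) ≡ countGE j xs + countGE j ys
  countGE-++ j xs ys = trans (cong length (filter-++ (j ≤?_) xs ys)) (length-++ (filter (j ≤?_) xs))

  countGE-∷ : ∀ j x xs → countGE j (x ∷ xs) ≡ countGE j [ x ] + countGE j xs
  countGE-∷ j x xs = countGE-++ j [ x ] xs

  countGE-all : ∀ {j xs} → All (j ≤_) xs → countGE j xs ≡ length xs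
  countGE-all {j} j≤xs = cong length (filter-all (j ≤?_) j≤xs)

  countGE-none : ∀ {j xs} → All (_< j) xs → countGE j xs ≡ 0
  countGE-none {j} xs<j = cong length (filter-none (j ≤?_) (All.map <⇒≱ xs<j))

  countGE-sum : ∀ j xs → countGE j xs ≡ sum (map (λ x → countGE j [ x ]) xs)
  countGE-sum j []       = refl
  countGE-sum j (x ∷ xs) = trans (countGE-∷ j x xs) (cong (countGE j [ x ] +_) (countGE-sum j xs))

  countGE-[]-accept : ∀ {i x} → i ≤ x → countGE i [ x ] ≡ 1
  countGE-[]-accept {i} i≤x = cong length (filter-accept (i ≤?_) i≤x)

  countGE-[]-reject : ∀ {i x} → ¬ i ≤ x → countGE i [ x ] ≡ 0
  countGE-[]-reject {i} i≰x = cong length (filter-reject (i ≤?_) i≰x)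

  countGE-[]-cong : ∀ {i x j y} → (i ≤ x → j ≤ y) → (j ≤ y → i ≤ x) → countGE i [ x ] ≡ countGE j [ y ]
  countGE-[]-cong {i} {x} {j} {y} to from with i ≤? x | j ≤? y
  ... | yes i≤x | yes j≤y = trans (countGE-[]-accept i≤x) (sym (countGE-[]-accept j≤y))
  ... | no  i≰x | no  j≰y = trans (countGE-[]-reject i≰x) (sym (countGE-[]-reject j≰y))
  ... | yes i≤x | no  j≰y = contradiction (to i≤x) j≰y
  ... | no  i≰x | yes j≤y = contradiction (from j≤y) i≰x

  sum-map-upTo-suc : ∀ (f : ℕ → ℕ) N → sum (map f (upTo (suc N))) ≡ sum (map f (upTo N)) + f N
  sum-map-upTo-suc f N = begin
    sum (map f (upTo (suc N)))        ≡⟨ cong (sum ∘ map f) (upTo-∷ʳ N) ⟨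
    sum (map f (upTo N ∷ʳ N))         ≡⟨ cong sum (map-++ f (upTo N) [ N ]) ⟩
    sum (map f (upTo N) ++ [ f N ])   ≡⟨ sum-++ (map f (upTo N)) [ f N ] ⟩
    sum (map f (upTo N)) + (f N + 0)  ≡⟨ cong (sum (map f (upTo N)) +_) (+-identityʳ (f N)) ⟩
    sum (map f (upTo N)) + f N        ∎

  sum-countGE-[]-upTo : ∀ N t x → sum (map (λ k → countGE (t + k) [ x ]) (upTo N)) ≡ N ⊓ (suc x ∸ t)
  sum-countGE-[]-upTo zero    t x = refl
  sum-countGE-[]-upTo (suc N) t x = begin
    sum (map ind (upTo (suc N)))   ≡⟨ sum-map-upTo-suc ind N ⟩
    sum (map ind (upTo N)) + ind N ≡⟨ cong (_+ ind N) (sum-countGE-[]-upTo N t x) ⟩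
    N ⊓ (suc x ∸ t) + ind N        ≡⟨ add-last ⟩
    suc N ⊓ (suc x ∸ t)            ∎
    where
    ind : ℕ → ℕ
    ind k = countGE (t + k) [ x ]
    add-last : N ⊓ (suc x ∸ t) + ind N ≡ suc N ⊓ (suc x ∸ t)
    add-last with t + N ≤? x
    ... | yes t+N≤x = begin
      N ⊓ (suc x ∸ t) + ind N   ≡⟨ cong₂ _+_ (m≤n⇒m⊓n≡m (<⇒≤ 1+N≤)) (countGE-[]-accept t+N≤x) ⟩
      N + 1                     ≡⟨ +-comm N 1 ⟩
      suc N                     ≡⟨ m≤n⇒m⊓n≡m 1+N≤ ⟨
      suc N ⊓ (suc x ∸ t)       ∎
      where
      1+N≤ : suc N ≤ suc x ∸ t
      1+N≤ = m+n≤o⇒m≤o∸n (suc N) (subst (_≤ suc x) (cong suc (+-comm t N)) (s≤s t+N≤x))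
    ... | no t+N≰x = begin
      N ⊓ (suc x ∸ t) + ind N   ≡⟨ cong₂ _+_ (m≥n⇒m⊓n≡n ≤N) (countGE-[]-reject t+N≰x) ⟩
      (suc x ∸ t) + 0           ≡⟨ +-identityʳ _ ⟩
      suc x ∸ t                 ≡⟨ m≥n⇒m⊓n≡n (m≤n⇒m≤1+n ≤N) ⟨
      suc N ⊓ (suc x ∸ t)       ∎
      where
      ≤N : suc x ∸ t ≤ N
      ≤N = m≤n+o⇒m∸n≤o (suc x) t (≰⇒> t+N≰x)

  sum-countGE-upTo : ∀ N t c → sum (map (λ k → countGE (t + k) c) (upTo N))
                               ≡ sum (map (λ x → N ⊓ (suc x ∸ t)) c)
  sum-countGE-upTo N t []       = sum-map-0 (upTo N)
  sum-countGE-upTo N t (x ∷ xs) = begin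
    sum (map (λ k → countGE (t + k) (x ∷ xs)) (upTo N))
      ≡⟨ cong sum (map-cong (λ k → countGE-∷ (t + k) x xs) (upTo N)) ⟩
    sum (map (λ k → countGE (t + k) [ x ] + countGE (t + k) xs) (upTo N))
      ≡⟨ sum-map-+ (λ k → countGE (t + k) [ x ]) (λ k → countGE (t + k) xs) (upTo N) ⟩
    sum (map (λ k → countGE (t + k) [ x ]) (upTo N)) + sum (map (λ k → countGE (t + k) xs) (upTo N))
      ≡⟨ cong₂ _+_ (sum-countGE-[]-upTo N t x) (sum-countGE-upTo N t xs) ⟩
    N ⊓ (suc x ∸ t) + sum (map (λ x → N ⊓ (suc x ∸ t)) xs)
      ∎

  sum-map-⊓-∸ : ∀ s N c → All (s ≤_) c → All (_≤ s + N) c →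
                 sum (map (λ x → N ⊓ (x ∸ s)) c) + s * length c ≡ sum c
  sum-map-⊓-∸ s N []       []          []          = *-zeroʳ s
  sum-map-⊓-∸ s N (x ∷ xs) (s≤x ∷ s≤xs) (x≤ ∷ xs≤) = begin
    (N ⊓ (x ∸ s) + S) + s * suc (length xs)
      ≡⟨ cong₂ (λ u v → (u + S) + v) (m≥n⇒m⊓n≡n (m≤n+o⇒m∸n≤o x s x≤)) (*-suc s (length xs)) ⟩
    ((x ∸ s) + S) + (s + s * length xs)
      ≡⟨ +-interchange (x ∸ s) S s (s * length xs) ⟩
    ((x ∸ s) + s) + (S + s * length xs)
      ≡⟨ cong₂ _+_ (m∸n+n≡m s≤x) (sum-map-⊓-∸ s N xs s≤xs xs≤) ⟩
    x + sum xs
      ∎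
    where
    S = sum (map (λ x → N ⊓ (x ∸ s)) xs)

  <countGE⇔≤nth : ∀ {c} → AllPairs _≥_ c → ∀ {i} → i < length c → ∀ j →
                   (i < countGE j c → j ≤ nth c i) × (j ≤ nth c i → i < countGE j c)
  <countGE⇔≤nth {x ∷ xs} (x≥xs ∷ xs↓) {i} i<n j with j ≤? x
  ... | yes j≤x rewrite countGE-∷ j x xs | countGE-[]-accept j≤x = at i i<n
    where
    at : ∀ i → i < suc (length xs) → (i < suc (countGE j xs) → j ≤ nth (x ∷ xs) i)
                                    × (j ≤ nth (x ∷ xs) i → i < suc (countGE j xs))
    at zero    _   = (λ _ → j≤x) , (λ _ → z<s)
    at (suc i) i<n with <countGE⇔≤nth xs↓ (s<s⁻¹ i<n) j
    ... | to , from = to ∘ s<s⁻¹ , s<s ∘ from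
  ... | no j≰x rewrite countGE-∷ j x xs | countGE-[]-reject j≰x
                     | countGE-none (All.map (λ y≤x → ≤-<-trans y≤x (≰⇒> j≰x)) x≥xs) =
    (λ ()) , (λ j≤cᵢ → contradiction (≤-trans j≤cᵢ (All-nth (≤-refl ∷ x≥xs) i<n)) j≰x)

  -- If a self-conjugate partition has Durfee square of side s and first s rows c, the rows below
  -- the square are the lengths of its columns s + 1, s + 2, …, read off from c.
  belowRows : ℕ → ℕ → List ℕ → List ℕ
  belowRows s N c = map (λ k → countGE (suc (s + k)) c) (upTo N)

  belowRows-≤ : ∀ {s N c} → length c ≡ s → All (_≤ s) (belowRows s N c)
  belowRows-≤ {s} {N} {c} refl = map⁺ (applyUpTo⁺₂ id N (λ k → length-filter (suc (s + k) ≤?_) c))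

  countGE-belowRows : ∀ {s N c} → AllPairs _≥_ c → ∀ {i} → i < length c →
                      countGE (suc i) (belowRows s N c) ≡ N ⊓ (nth c i ∸ s)
  countGE-belowRows {s} {N} {c} c↓ {i} i<n = begin
    countGE (suc i) (belowRows s N c)
      ≡⟨ countGE-sum (suc i) (belowRows s N c) ⟩
    sum (map (λ y → countGE (suc i) [ y ]) (belowRows s N c))
      ≡⟨ cong sum (map-∘ (upTo N)) ⟨
    sum (map (λ k → countGE (suc i) [ countGE (suc (s + k)) c ]) (upTo N))
      ≡⟨ cong sum (map-cong (λ k → countGE-[]-cong (proj₁ (row k)) (proj₂ (row k))) (upTo N)) ⟩
    sum (map (λ k → countGE (suc s + k) [ nth c i ]) (upTo N))
      ≡⟨ sum-countGE-[]-upTo N (suc s) (nth c i) ⟩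
    N ⊓ (nth c i ∸ s)
      ∎
    where
    row : ∀ k → (i < countGE (suc (s + k)) c → suc (s + k) ≤ nth c i)
              × (suc (s + k) ≤ nth c i → i < countGE (suc (s + k)) c)
    row k = <countGE⇔≤nth c↓ i<n (suc (s + k))

  sum-belowRows : ∀ {s N c} → length c ≡ s → All (s ≤_) c → All (_≤ s + N) c →
                  sum (belowRows s N c) + s * s ≡ sum c
  sum-belowRows {s} {N} {c} refl s≤c c≤ = begin
    sum (belowRows s N c) + s * s                    ≡⟨ cong (_+ s * s) (sum-countGE-upTo N (suc s) c) ⟩
    sum (map (λ x → N ⊓ (x ∸ s)) c) + s * length c   ≡⟨ sum-map-⊓-∸ s N c s≤c c≤ ⟩
    sum c                                            ∎

  conjugate-++-belowRows : ∀ {y ys s N} → let c = y ∷ ys in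
    AllPairs _≥_ c → length c ≡ s → All (s ≤_) c → s + N ≡ y →
    conjugate (c ++ belowRows s N c) ≡ c ++ belowRows s N c
  conjugate-++-belowRows {y} {ys} {s} {N} c↓@(y≥ys ∷ _) len s≤c s+N≡y = begin
    map (λ j → countGE j P) (map suc (upTo y))
      ≡⟨ map-∘ (upTo y) ⟨
    map row (upTo y)
      ≡⟨ cong (map row ∘ upTo) s+N≡y ⟨
    map row (upTo (s + N))
      ≡⟨ cong (map row) (upTo-+ s N) ⟩
    map row (upTo s ++ map (s +_) (upTo N))
      ≡⟨ map-++ row (upTo s) _ ⟩
    map row (upTo s) ++ map row (map (s +_) (upTo N))
      ≡⟨ cong₂ _++_ rows-above rows-below ⟩
    c ++ B
      ∎
    where
    c = y ∷ ys
    B = belowRows s N c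
    P = c ++ B
    row : ℕ → ℕ
    row i = countGE (suc i) P

    row-above : ∀ {i} → i < s → row i ≡ nth c i
    row-above {i} i<s = begin
      countGE (suc i) (c ++ B)
        ≡⟨ countGE-++ (suc i) c B ⟩
      countGE (suc i) c + countGE (suc i) B
        ≡⟨ cong₂ _+_ (trans (countGE-all (All.map (≤-trans i<s) s≤c)) len) (countGE-belowRows c↓ i<n) ⟩
      s + N ⊓ (nth c i ∸ s)
        ≡⟨ cong (s +_) (m≥n⇒m⊓n≡n (m≤n+o⇒m∸n≤o (nth c i) s cᵢ≤s+N)) ⟩
      s + (nth c i ∸ s)
        ≡⟨ m+[n∸m]≡n (All-nth s≤c i<n) ⟩
      nth c i
        ∎
      where
      i<n : i < length c
      i<n = subst (i <_) (sym len) i<s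
      cᵢ≤s+N : nth c i ≤ s + N
      cᵢ≤s+N = subst (nth c i ≤_) (sym s+N≡y) (All-nth (≤-refl ∷ y≥ys) i<n)

    rows-above : map row (upTo s) ≡ c
    rows-above = trans (map-upTo-cong s row-above) (subst (λ n → map (nth c) (upTo n) ≡ c) len (map-nth-upTo c))

    B< : ∀ {k} → All (_< suc (s + k)) B
    B< {k} = All.map (λ b≤s → s≤s (≤-trans b≤s (m≤m+n s k))) (belowRows-≤ {N = N} {c = c} len)

    row-below : ∀ k → row (s + k) ≡ countGE (suc (s + k)) c
    row-below k = begin
      countGE (suc (s + k)) (c ++ B)
        ≡⟨ countGE-++ (suc (s + k)) c B ⟩
      countGE (suc (s + k)) c + countGE (suc (s + k)) B
        ≡⟨ cong (countGE (suc (s + k)) c +_) (countGE-none B<) ⟩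
      countGE (suc (s + k)) c + 0
        ≡⟨ +-identityʳ _ ⟩
      countGE (suc (s + k)) c
        ∎

    rows-below : map row (map (s +_) (upTo N)) ≡ B
    rows-below = trans (sym (map-∘ (upTo N))) (map-cong row-below (upTo N))

  addPositions : ℕ → List ℕ → List ℕ
  addPositions i []       = []
  addPositions i (x ∷ xs) = x + i ∷ addPositions (suc i) xs

  zipWith-addPositions : ∀ a (f : ℕ → ℕ) i → (∀ k → f k ≡ i + k) →
                         zipWith (λ j aⱼ → aⱼ + j) (applyUpTo f (length a)) a ≡ addPositions i a
  zipWith-addPositions []       f i f≡ = refl
  zipWith-addPositions (x ∷ xs) f i f≡ =
    cong₂ _∷_ (cong (x +_) (trans (f≡ 0) (+-identityʳ i)))
              (zipWith-addPositions xs (f ∘ suc) (suc i) (λ k → trans (f≡ (suc k)) (+-suc i k)))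

  length-addPositions : ∀ i a → length (addPositions i a) ≡ length a
  length-addPositions i []       = refl
  length-addPositions i (x ∷ xs) = cong suc (length-addPositions (suc i) xs)

  length≤head : ∀ {x xs} → AllPairs _>_ (x ∷ xs) → length xs ≤ x
  length≤head {xs = []}     _                      = z≤n
  length≤head {xs = y ∷ ys} ((y<x ∷ _) ∷ y∷ys↓) = ≤-trans (s≤s (length≤head y∷ys↓)) y<x

  addPositions-≤head : ∀ {x xs} i → AllPairs _>_ (x ∷ xs) → All (_≤ x + i) (addPositions (suc i) xs)
  addPositions-≤head {xs = []}     i _                       = []
  addPositions-≤head {x} {y ∷ ys} i ((y<x ∷ _) ∷ y∷ys↓) =
    y+1+i≤x+i ∷ All.map (λ z≤ → ≤-trans z≤ y+1+i≤x+i) (addPositions-≤head (suc i) y∷ys↓)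
    where
    y+1+i≤x+i : y + suc i ≤ x + i
    y+1+i≤x+i = subst (_≤ x + i) (sym (+-suc y i)) (+-monoˡ-≤ i y<x)

  addPositions-decreasing : ∀ i {a} → AllPairs _>_ a → AllPairs _≥_ (addPositions i a)
  addPositions-decreasing i {[]}     []                = []
  addPositions-decreasing i {x ∷ xs} a↓@(_ ∷ xs↓) =
    addPositions-≤head i a↓ ∷ addPositions-decreasing (suc i) xs↓

  length≤addPositions : ∀ i {a} → AllPairs _>_ a → All (length a + i ≤_) (addPositions (suc i) a)
  length≤addPositions i {[]}     []                = []
  length≤addPositions i {x ∷ xs} a↓@(_ ∷ xs↓) =
    subst (suc (length xs + i) ≤_) (sym (+-suc x i)) (s≤s (+-monoˡ-≤ i (length≤head a↓)))
    ∷ All.map (λ {z} ≤z → subst (_≤ z) (+-suc (length xs) i) ≤z) (length≤addPositions (suc i) xs↓)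

  sum-addPositions : ∀ i a → 2 * sum (addPositions i a) + length a
                             ≡ 2 * sum a + length a * length a + 2 * i * length a
  sum-addPositions i []       = sym (*-zeroʳ (2 * i))
  sum-addPositions i (x ∷ xs) = begin
    2 * (x + i + sum (addPositions (suc i) xs)) + suc (length xs)
      ≡⟨ regroup x i (sum (addPositions (suc i) xs)) (length xs) ⟩
    (2 * sum (addPositions (suc i) xs) + length xs) + (2 * x + 2 * i + 1)
      ≡⟨ cong (_+ (2 * x + 2 * i + 1)) (sum-addPositions (suc i) xs) ⟩
    (2 * sum xs + length xs * length xs + 2 * suc i * length xs) + (2 * x + 2 * i + 1)
      ≡⟨ expand x i (sum xs) (length xs) ⟩
    2 * (x + sum xs) + suc (length xs) * suc (length xs) + 2 * i * suc (length xs)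
      ∎
    where
    regroup : ∀ x i S L → 2 * (x + i + S) + suc L ≡ (2 * S + L) + (2 * x + 2 * i + 1)
    regroup = ℕ-Solver.solve-∀
    expand : ∀ x i T L → (2 * T + L * L + 2 * suc i * L) + (2 * x + 2 * i + 1)
                         ≡ 2 * (x + T) + suc L * suc L + 2 * i * suc L
    expand = ℕ-Solver.solve-∀

  fromSortedArms : List ℕ → List ℕ
  fromSortedArms a = rows ++ belowDiagonal (length a) rows a
    where
    rows = zipWith (λ i aᵢ → aᵢ + i) (oneTo (length a)) a

  module Durfee {x xs} (a↓ : AllPairs _>_ (x ∷ xs)) where
    s N : ℕ
    s = suc (length xs)
    N = suc x ∸ s
    c : List ℕ
    c = addPositions 1 (x ∷ xs)

    fromSortedArms≡ : fromSortedArms (x ∷ xs) ≡ c ++ belowRows s N c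
    fromSortedArms≡ = cong (λ rows → rows ++ belowRows s N rows)
      (trans (cong (λ ks → zipWith (λ i aᵢ → aᵢ + i) ks (x ∷ xs)) (map-upTo suc s))
             (zipWith-addPositions (x ∷ xs) suc 1 (λ _ → refl)))

    s+N≡x+1 : s + N ≡ x + 1
    s+N≡x+1 = trans (m+[n∸m]≡n (s≤s (length≤head a↓))) (+-comm 1 x)

    s≤c : All (s ≤_) c
    s≤c = All.map (λ {z} ≤z → subst (_≤ z) (+-identityʳ s) ≤z) (length≤addPositions 0 a↓)

    c≤s+N : All (_≤ s + N) c
    c≤s+N = All.map (λ z≤ → ≤-trans z≤ (≤-reflexive (sym s+N≡x+1))) (≤-refl ∷ addPositions-≤head 1 a↓)

  fromSortedArms-self-conjugate : ∀ {a} → AllPairs _>_ a → conjugate (fromSortedArms a) ≡ fromSortedArms a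
  fromSortedArms-self-conjugate {[]}     _  = refl
  fromSortedArms-self-conjugate {x ∷ xs} a↓ =
    subst (λ P → conjugate P ≡ P) (sym fromSortedArms≡)
      (conjugate-++-belowRows (addPositions-decreasing 1 a↓) (length-addPositions 1 (x ∷ xs)) s≤c s+N≡x+1)
    where open Durfee a↓

  sum-fromSortedArms : ∀ {a} → AllPairs _>_ a → sum (fromSortedArms a) ≡ length a + 2 * sum a
  sum-fromSortedArms {[]}     _  = refl
  sum-fromSortedArms {x ∷ xs} a↓ =
    trans (cong sum fromSortedArms≡)
          (cancel (sum (c ++ B)) (sum c) (sum (x ∷ xs)) s sum-rows (sum-addPositions 1 (x ∷ xs)))
    where
    open Durfee a↓
    B = belowRows s N c

    sum-rows : sum (c ++ B) + s * s ≡ 2 * sum c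
    sum-rows = begin
      sum (c ++ B) + s * s       ≡⟨ cong (_+ s * s) (sum-++ c B) ⟩
      sum c + sum B + s * s      ≡⟨ +-assoc (sum c) (sum B) (s * s) ⟩
      sum c + (sum B + s * s)    ≡⟨ cong (sum c +_) (sum-belowRows (length-addPositions 1 (x ∷ xs)) s≤c c≤s+N) ⟩
      sum c + sum c              ≡⟨ cong (sum c +_) (+-identityʳ (sum c)) ⟨
      2 * sum c                  ∎

    cancel : ∀ p q r d → p + d * d ≡ 2 * q → 2 * q + d ≡ 2 * r + d * d + 2 * 1 * d → p ≡ d + 2 * r
    cancel p q r d p+d² 2q+d = +-cancelʳ-≡ (d * d + d) p (d + 2 * r) (begin
      p + (d * d + d)                  ≡⟨ +-assoc p (d * d) d ⟨
      p + d * d + d                    ≡⟨ cong (_+ d) p+d² ⟩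
      2 * q + d                        ≡⟨ 2q+d ⟩
      2 * r + d * d + 2 * 1 * d        ≡⟨ regroup r d ⟩
      d + 2 * r + (d * d + d)          ∎)
      where
      regroup : ∀ r d → 2 * r + d * d + 2 * 1 * d ≡ d + 2 * r + (d * d + d)
      regroup = ℕ-Solver.solve-∀

  AllPairs-reverse : ∀ {R : ℕ → ℕ → Set} {xs} → AllPairs R xs → AllPairs (flip R) (reverse xs)
  AllPairs-reverse {xs = []}     []          = []
  AllPairs-reverse {R} {x ∷ xs} (Rx ∷ xs↓) =
    subst (AllPairs (flip R)) (sym (unfold-reverse x xs))
      (AllPairs.++⁺ (AllPairs-reverse xs↓) ([] ∷ [])
                    (↭.All-resp-↭ (↭-sym (↭.↭-reverse xs)) (All.map (λ r → r ∷ []) Rx)))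

  sortDesc-↭ : ∀ A → sortDesc A ↭ A
  sortDesc-↭ A = ↭-trans (↭.↭-reverse (sort A)) (sort-↭ A)

  sortDesc-strictlyDecreasing : ∀ {A} → Unique A → AllPairs _>_ (sortDesc A)
  sortDesc-strictlyDecreasing {A} A! = AllPairs-reverse (AllPairs.zipWith (λ (x≤y , x≢y) → ≤∧≢⇒< x≤y x≢y)
    (Sorted⇒AllPairs ≤-totalOrder (sort-↗ A) , Unique-resp-↭ (↭⇒↭ₛ (↭-sym (sort-↭ A))) A!))

  sortDesc-↭-cong : ∀ {A B} → A ↭ B → sortDesc A ≡ sortDesc B
  sortDesc-↭-cong {A} {B} A↭B = cong reverse (Pointwise-≡⇒≡ (↗↭↗⇒≋ ≤-totalOrder (sort-↗ A) (sort-↗ B)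
    (↭⇒↭ₛ (↭-trans (sort-↭ A) (↭-trans A↭B (↭-sym (sort-↭ B)))))))

  fromArmsLegs-↭ : ∀ {A L} → L ↭ A → fromArmsLegs A L ≡ fromSortedArms (sortDesc A)
  fromArmsLegs-↭ {A} L↭A =
    cong (λ l → rows ++ belowDiagonal (length a) (zipWith (λ j lⱼ → lⱼ + j) (oneTo (length a)) l) l)
         (sortDesc-↭-cong L↭A)
    where
    a = sortDesc A
    rows = zipWith (λ i aᵢ → aᵢ + i) (oneTo (length a)) a

  fromArmsLegs-self-conjugate : ∀ {A L} → Unique A → L ↭ A → conjugate (fromArmsLegs A L) ≡ fromArmsLegs A L
  fromArmsLegs-self-conjugate A! L↭A = subst (λ P → conjugate P ≡ P) (sym (fromArmsLegs-↭ L↭A))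
    (fromSortedArms-self-conjugate (sortDesc-strictlyDecreasing A!))

  diagonalHookSum : List ℕ → ℕ
  diagonalHookSum A = length A + 2 * sum A

  size-fromArmsLegs : ∀ {A L} → Unique A → L ↭ A → size (fromArmsLegs A L) ≡ diagonalHookSum A
  size-fromArmsLegs {A} {L} A! L↭A = begin
    sum (fromArmsLegs A L)                           ≡⟨ cong sum (fromArmsLegs-↭ L↭A) ⟩
    sum (fromSortedArms (sortDesc A))                ≡⟨ sum-fromSortedArms (sortDesc-strictlyDecreasing A!) ⟩
    length (sortDesc A) + 2 * sum (sortDesc A)
      ≡⟨ cong₂ (λ l t → l + 2 * t) (↭.↭-length (sortDesc-↭ A)) (sum-↭ (sortDesc-↭ A)) ⟩
    length A + 2 * sum A                             ∎

module ArmsAndLegs where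

  open import Defs
  open import Data.Nat
  open import Data.Nat.Properties
  open import Data.Nat.DivMod using (_%_; [m+kn]%n≡m%n; m<n⇒m%n≡m)
  open import Data.Integer using (+_; -[1+_]; -_)
  open import Data.Integer.Properties using (neg-involutive)
  open import Data.List using (List; []; _∷_; _++_; _∷ʳ_; map; concat; reverse; upTo)
  open import Data.List.Properties using (unfold-reverse; concat-++; ++-identityʳ)
  open import Data.List.Relation.Unary.All as All using (All; []; _∷_)
  open import Data.List.Relation.Unary.All.Properties using (applyUpTo⁺₂; map⁺; concat⁺)
  open import Data.List.Relation.Unary.AllPairs using (AllPairs; []; _∷_; allPairs?)
  open import Data.List.Relation.Unary.Unique.Propositional using (Unique)
  import Data.List.Relation.Unary.Unique.Propositional.Properties as Unique
  open import Data.List.Relation.Binary.Permutation.Propositional using (_↭_; ↭-refl; module PermutationReasoning)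
  import Data.List.Relation.Binary.Permutation.Propositional.Properties as ↭
  open import Data.List.Relation.Binary.Pointwise using (Pointwise-≡⇒≡; []; _∷_)
  open import Data.Product using (_×_; _,_; proj₁)
  open import Function using (id; _∘_)
  open import Relation.Nullary.Decidable using (toWitness)
  open import Relation.Binary.PropositionalEquality
  open FrobeniusCoordinates using (fromArmsLegs-self-conjugate; size-fromArmsLegs; diagonalHookSum)

  legsAt-mirror : ∀ j v → legsAt (j , v) ≡ armsAt (8 ∸ j , - v)
  legsAt-mirror j (+ zero)  = refl
  legsAt-mirror j (+ suc k) = refl
  legsAt-mirror j -[1+ k ]  =
    cong (λ r → map (λ q → q * 9 + r) (upTo (suc k))) (trans (∸-+-assoc 9 j 1) (cong (9 ∸_) (+-comm j 1)))

  legsAt-mirror⁻ : ∀ j v → legsAt (j , - v) ≡ armsAt (8 ∸ j , v)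
  legsAt-mirror⁻ j v = trans (legsAt-mirror j (- v)) (cong (λ u → armsAt (8 ∸ j , u)) (neg-involutive v))

  legBlocks≡reverse : ∀ t → map legsAt (indexed (nine t)) ≡ reverse (map armsAt (indexed (nine t)))
  legBlocks≡reverse ⟨ x , y , z , w ⟩ = Pointwise-≡⇒≡
    (legsAt-mirror⁻ 0 w ∷ legsAt-mirror⁻ 1 z ∷ legsAt-mirror⁻ 2 y ∷ legsAt-mirror⁻ 3 x ∷ refl ∷
     legsAt-mirror 5 x ∷ legsAt-mirror 6 y ∷ legsAt-mirror 7 z ∷ legsAt-mirror 8 w ∷ [])

  concat-reverse-↭ : ∀ (bs : List (List ℕ)) → concat (reverse bs) ↭ concat bs
  concat-reverse-↭ []       = ↭-refl
  concat-reverse-↭ (b ∷ bs) = begin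
    concat (reverse (b ∷ bs))      ≡⟨ cong concat (unfold-reverse b bs) ⟩
    concat (reverse bs ∷ʳ b)       ≡⟨ concat-++ (reverse bs) (b ∷ []) ⟨
    concat (reverse bs) ++ b ++ [] ≡⟨ cong (concat (reverse bs) ++_) (++-identityʳ b) ⟩
    concat (reverse bs) ++ b       ↭⟨ ↭.++⁺ʳ b (concat-reverse-↭ bs) ⟩
    concat bs ++ b                 ↭⟨ ↭.++-comm (concat bs) b ⟩
    b ++ concat bs                 ∎
    where open PermutationReasoning

  legSet↭armSet : ∀ t → legSet t ↭ armSet t
  legSet↭armSet t =
    subst (_↭ armSet t) (cong concat (sym (legBlocks≡reverse t))) (concat-reverse-↭ (map armsAt (indexed (nine t))))

  armsAt-residue : ∀ {j} v → j < 9 → All (λ n → n % 9 ≡ j) (armsAt (j , v))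
  armsAt-residue {j} (+ k)    j<9 = map⁺ (applyUpTo⁺₂ id k (λ q →
    trans (cong (_% 9) (+-comm (q * 9) j)) (trans ([m+kn]%n≡m%n j q 9) (m<n⇒m%n≡m j<9))))
  armsAt-residue     -[1+ k ] _   = []

  armsAt-unique : ∀ j v → Unique (armsAt (j , v))
  armsAt-unique j (+ k)    = Unique.map⁺ (λ {a} {b} e → *-cancelʳ-≡ a b 9 (+-cancelʳ-≡ j _ _ e)) (Unique.upTo⁺ k)
  armsAt-unique j -[1+ k ] = []

  concat-armsAt-residue : ∀ {j ps} → All (λ p → j < proj₁ p × proj₁ p < 9) ps →
                          All (λ n → j < n % 9) (concat (map armsAt ps))
  concat-armsAt-residue = concat⁺ ∘ map⁺ ∘ All.map λ { {_ , v} (j< , <9) →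
    All.map (λ e → subst (_ <_) (sym e) j<) (armsAt-residue v <9) }

  concat-armsAt-unique : ∀ {ps} → AllPairs (λ p q → proj₁ p < proj₁ q) ps → All (λ p → proj₁ p < 9) ps →
                         Unique (concat (map armsAt ps))
  concat-armsAt-unique {[]}          []          []          = []
  concat-armsAt-unique {(j , v) ∷ _} (j< ∷ ps↑) (j<9 ∷ ps<9) =
    Unique.++⁺ (armsAt-unique j v) (concat-armsAt-unique ps↑ ps<9) λ (n∈ , n∈′) →
      <-irrefl (sym (All.lookup (armsAt-residue v j<9) n∈))
               (All.lookup (concat-armsAt-residue (All.zip (j< , ps<9))) n∈′)

  armSet-unique : ∀ t → Unique (armSet t)
  armSet-unique t@(⟨ _ , _ , _ , _ ⟩) = concat-armsAt-unique
    (toWitness {a? = allPairs? (λ p q → proj₁ p <? proj₁ q) (indexed (nine t))} _)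
    (toWitness {a? = All.all? (λ p → proj₁ p <? 9) (indexed (nine t))} _)

  partitionOf-self-conjugate : ∀ t → conjugate (partitionOf t) ≡ partitionOf t
  partitionOf-self-conjugate t = fromArmsLegs-self-conjugate (armSet-unique t) (legSet↭armSet t)

  size-partitionOf : ∀ t → size (partitionOf t) ≡ diagonalHookSum (armSet t)
  size-partitionOf t = size-fromArmsLegs (armSet-unique t) (legSet↭armSet t)

module QuadraticSize where

  open import Defs
  open import Data.Nat as ℕ using (ℕ; zero; suc)
  import Data.Nat.Properties as ℕ
  import Data.Nat.Tactic.RingSolver as ℕ-Solver
  open import Data.Nat.ListAction using (sum)
  open import Data.Nat.ListAction.Properties using (sum-++)
  open import Data.Integer using (ℤ; +_; -[1+_]; -_; _+_; _*_; _-_)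
  import Data.Integer.Properties as ℤ
  open import Data.Integer.Tactic.RingSolver using (solve-∀)
  open import Data.List using ([]; _∷_; _++_; map; concat; length; upTo)
  open import Data.List.Properties using (length-++; length-map; length-upTo)
  open import Data.Product using (_,_)
  open import Relation.Binary.PropositionalEquality
  open FrobeniusCoordinates using (diagonalHookSum; sum-map-upTo-suc)
  open ArmsAndLegs using (size-partitionOf; partitionOf-self-conjugate)

  q : ℤ → ℤ → ℤ
  q h v = + 9 * (v * v) + + 2 * h * v

  Q : Tuple4 → ℤ
  Q ⟨ x , y , z , w ⟩ = q (+ 1) x + q (+ 2) y + q (+ 3) z + q (+ 4) w

  pos-+₄ : ∀ a b c d → + (a ℕ.+ b ℕ.+ c ℕ.+ d) ≡ + a + + b + + c + + d
  pos-+₄ a b c d =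
    trans (ℤ.pos-+ (a ℕ.+ b ℕ.+ c) d) (cong (_+ + d) (trans (ℤ.pos-+ (a ℕ.+ b) c) (cong (_+ + c) (ℤ.pos-+ a b))))

  diagonalHookSum-++ : ∀ xs ys → diagonalHookSum (xs ++ ys) ≡ diagonalHookSum xs ℕ.+ diagonalHookSum ys
  diagonalHookSum-++ xs ys rewrite length-++ xs {ys} | sum-++ xs ys =
    regroup (length xs) (length ys) (sum xs) (sum ys)
    where
    regroup : ∀ a b c d → a ℕ.+ b ℕ.+ 2 ℕ.* (c ℕ.+ d) ≡ a ℕ.+ 2 ℕ.* c ℕ.+ (b ℕ.+ 2 ℕ.* d)
    regroup = ℕ-Solver.solve-∀

  diagonalHookSum-concat : ∀ bs → diagonalHookSum (concat bs) ≡ sum (map diagonalHookSum bs)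
  diagonalHookSum-concat []       = refl
  diagonalHookSum-concat (b ∷ bs) =
    trans (diagonalHookSum-++ b (concat bs)) (cong (diagonalHookSum b ℕ.+_) (diagonalHookSum-concat bs))

  twice-sum-armsAt : ∀ j k → 2 ℕ.* sum (armsAt (j , + k)) ℕ.+ 9 ℕ.* k
                             ≡ 9 ℕ.* (k ℕ.* k) ℕ.+ 2 ℕ.* j ℕ.* k
  twice-sum-armsAt j zero    = sym (ℕ.*-zeroʳ (2 ℕ.* j))
  twice-sum-armsAt j (suc k) = begin
    2 ℕ.* sum (map f (upTo (suc k))) ℕ.+ 9 ℕ.* suc k
      ≡⟨ cong (λ S → 2 ℕ.* S ℕ.+ 9 ℕ.* suc k) (sum-map-upTo-suc f k) ⟩
    2 ℕ.* (sum (map f (upTo k)) ℕ.+ f k) ℕ.+ 9 ℕ.* suc k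
      ≡⟨ split (sum (map f (upTo k))) j k ⟩
    (2 ℕ.* sum (map f (upTo k)) ℕ.+ 9 ℕ.* k) ℕ.+ (18 ℕ.* k ℕ.+ 2 ℕ.* j ℕ.+ 9)
      ≡⟨ cong (ℕ._+ (18 ℕ.* k ℕ.+ 2 ℕ.* j ℕ.+ 9)) (twice-sum-armsAt j k) ⟩
    9 ℕ.* (k ℕ.* k) ℕ.+ 2 ℕ.* j ℕ.* k ℕ.+ (18 ℕ.* k ℕ.+ 2 ℕ.* j ℕ.+ 9)
      ≡⟨ square j k ⟩
    9 ℕ.* (suc k ℕ.* suc k) ℕ.+ 2 ℕ.* j ℕ.* suc k
      ∎
    where
    open ≡-Reasoning
    f : ℕ → ℕ
    f q = q ℕ.* 9 ℕ.+ j
    split : ∀ S j k → 2 ℕ.* (S ℕ.+ (k ℕ.* 9 ℕ.+ j)) ℕ.+ 9 ℕ.* suc k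
                      ≡ (2 ℕ.* S ℕ.+ 9 ℕ.* k) ℕ.+ (18 ℕ.* k ℕ.+ 2 ℕ.* j ℕ.+ 9)
    split = ℕ-Solver.solve-∀
    square : ∀ j k → 9 ℕ.* (k ℕ.* k) ℕ.+ 2 ℕ.* j ℕ.* k ℕ.+ (18 ℕ.* k ℕ.+ 2 ℕ.* j ℕ.+ 9)
                     ≡ 9 ℕ.* (suc k ℕ.* suc k) ℕ.+ 2 ℕ.* j ℕ.* suc k
    square = ℕ-Solver.solve-∀

  diagonalHookSum-armsAt : ∀ j k → + diagonalHookSum (armsAt (j , + k)) ≡ + 9 * (+ k * + k) + (+ 2 * + j - + 8) * + k
  diagonalHookSum-armsAt j k = begin
    + (length (map f (upTo k)) ℕ.+ 2 ℕ.* S)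
      ≡⟨ cong (λ l → + (l ℕ.+ 2 ℕ.* S)) (trans (length-map f (upTo k)) (length-upTo k)) ⟩
    + (k ℕ.+ 2 ℕ.* S)
      ≡⟨ trans (ℤ.pos-+ k (2 ℕ.* S)) (cong (_+_ (+ k)) (ℤ.pos-* 2 S)) ⟩
    + k + + 2 * + S
      ≡⟨ eliminate-S (+ k) (+ S) (+ j) twice-sum ⟩
    + 9 * (+ k * + k) + (+ 2 * + j - + 8) * + k
      ∎
    where
    open ≡-Reasoning
    f : ℕ → ℕ
    f q = q ℕ.* 9 ℕ.+ j
    S = sum (map f (upTo k))

    twice-sum : + 2 * + S + + 9 * + k ≡ + 9 * (+ k * + k) + + 2 * + j * + k
    twice-sum = begin
      + 2 * + S + + 9 * + k
        ≡⟨ trans (ℤ.pos-+ (2 ℕ.* S) (9 ℕ.* k)) (cong₂ _+_ (ℤ.pos-* 2 S) (ℤ.pos-* 9 k)) ⟨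
      + (2 ℕ.* S ℕ.+ 9 ℕ.* k)
        ≡⟨ cong +_ (twice-sum-armsAt j k) ⟩
      + (9 ℕ.* (k ℕ.* k) ℕ.+ 2 ℕ.* j ℕ.* k)
        ≡⟨ ℤ.pos-+ (9 ℕ.* (k ℕ.* k)) (2 ℕ.* j ℕ.* k) ⟩
      + (9 ℕ.* (k ℕ.* k)) + + (2 ℕ.* j ℕ.* k)
        ≡⟨ cong₂ _+_ (trans (ℤ.pos-* 9 (k ℕ.* k)) (cong (+ 9 *_) (ℤ.pos-* k k)))
                     (trans (ℤ.pos-* (2 ℕ.* j) k) (cong (_* + k) (ℤ.pos-* 2 j))) ⟩
      + 9 * (+ k * + k) + + 2 * + j * + k
        ∎

    eliminate-S : ∀ K S J → + 2 * S + + 9 * K ≡ + 9 * (K * K) + + 2 * J * K →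
                  K + + 2 * S ≡ + 9 * (K * K) + (+ 2 * J - + 8) * K
    eliminate-S K S J e = begin
      K + + 2 * S                               ≡⟨ add-sub K S ⟩
      (+ 2 * S + + 9 * K) - + 8 * K             ≡⟨ cong (_- + 8 * K) e ⟩
      (+ 9 * (K * K) + + 2 * J * K) - + 8 * K   ≡⟨ collect K J ⟩
      + 9 * (K * K) + (+ 2 * J - + 8) * K       ∎
      where
      add-sub : ∀ K S → K + + 2 * S ≡ (+ 2 * S + + 9 * K) - + 8 * K
      add-sub = solve-∀
      collect : ∀ K J → (+ 9 * (K * K) + + 2 * J * K) - + 8 * K ≡ + 9 * (K * K) + (+ 2 * J - + 8) * K
      collect = solve-∀

  diagonalHookSum-mirror : ∀ j h → j ℕ.+ h ≡ 4 → ∀ v →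
    + (diagonalHookSum (armsAt (j , - v)) ℕ.+ diagonalHookSum (armsAt (4 ℕ.+ h , v))) ≡ q (+ h) v
  diagonalHookSum-mirror j h _ (+ k) = begin
    + (diagonalHookSum (armsAt (j , - + k)) ℕ.+ diagonalHookSum (armsAt (4 ℕ.+ h , + k)))
      ≡⟨ cong (λ d → + (d ℕ.+ diagonalHookSum (armsAt (4 ℕ.+ h , + k)))) (no-arms k) ⟩
    + diagonalHookSum (armsAt (4 ℕ.+ h , + k))
      ≡⟨ diagonalHookSum-armsAt (4 ℕ.+ h) k ⟩
    + 9 * (+ k * + k) + (+ 2 * + (4 ℕ.+ h) - + 8) * + k
      ≡⟨ cong (λ H → + 9 * (+ k * + k) + (+ 2 * H - + 8) * + k) (ℤ.pos-+ 4 h) ⟩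
    + 9 * (+ k * + k) + (+ 2 * (+ 4 + + h) - + 8) * + k
      ≡⟨ simplify (+ k) (+ h) ⟩
    q (+ h) (+ k)
      ∎
    where
    open ≡-Reasoning
    no-arms : ∀ k → diagonalHookSum (armsAt (j , - + k)) ≡ 0
    no-arms zero    = refl
    no-arms (suc k) = refl
    simplify : ∀ K H → + 9 * (K * K) + (+ 2 * (+ 4 + H) - + 8) * K ≡ + 9 * (K * K) + + 2 * H * K
    simplify = solve-∀
  diagonalHookSum-mirror j h j+h≡4 -[1+ k ] = begin
    + (diagonalHookSum (armsAt (j , + suc k)) ℕ.+ 0)
      ≡⟨ cong +_ (ℕ.+-identityʳ _) ⟩
    + diagonalHookSum (armsAt (j , + suc k))
      ≡⟨ diagonalHookSum-armsAt j (suc k) ⟩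
    + 9 * (+ suc k * + suc k) + (+ 2 * + j - + 8) * + suc k
      ≡⟨ cong (λ J → + 9 * (+ suc k * + suc k) + (+ 2 * J - + 8) * + suc k) j≡4-h ⟩
    + 9 * (+ suc k * + suc k) + (+ 2 * (+ 4 - + h) - + 8) * + suc k
      ≡⟨ simplify (+ suc k) (+ h) ⟩
    q (+ h) -[1+ k ]
      ∎
    where
    open ≡-Reasoning
    j≡4-h : + j ≡ + 4 - + h
    j≡4-h = trans (add-sub (+ j) (+ h)) (cong (_- + h) (trans (sym (ℤ.pos-+ j h)) (cong +_ j+h≡4)))
      where
      add-sub : ∀ J H → J ≡ (J + H) - H
      add-sub = solve-∀
    simplify : ∀ K H → + 9 * (K * K) + (+ 2 * (+ 4 - H) - + 8) * K ≡ + 9 * ((- K) * (- K)) + + 2 * H * (- K)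
    simplify = solve-∀

  size≡Q : ∀ t → + size (partitionOf t) ≡ Q t
  size≡Q t@(⟨ x , y , z , w ⟩) = begin
    + size (partitionOf t)
      ≡⟨ cong +_ (trans (size-partitionOf t) (diagonalHookSum-concat (map armsAt (indexed (nine t))))) ⟩
    + (B 0 (- w) ℕ.+ (B 1 (- z) ℕ.+ (B 2 (- y) ℕ.+ (B 3 (- x) ℕ.+ (0 ℕ.+
        (B 5 x ℕ.+ (B 6 y ℕ.+ (B 7 z ℕ.+ (B 8 w ℕ.+ 0)))))))))
      ≡⟨ cong +_ (pair-up (B 0 (- w)) (B 1 (- z)) (B 2 (- y)) (B 3 (- x)) (B 5 x) (B 6 y) (B 7 z) (B 8 w)) ⟩
    + ((B 3 (- x) ℕ.+ B 5 x) ℕ.+ (B 2 (- y) ℕ.+ B 6 y) ℕ.+ (B 1 (- z) ℕ.+ B 7 z) ℕ.+ (B 0 (- w) ℕ.+ B 8 w))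
      ≡⟨ pos-+₄ (B 3 (- x) ℕ.+ B 5 x) (B 2 (- y) ℕ.+ B 6 y) (B 1 (- z) ℕ.+ B 7 z) (B 0 (- w) ℕ.+ B 8 w) ⟩
    + (B 3 (- x) ℕ.+ B 5 x) + + (B 2 (- y) ℕ.+ B 6 y) + + (B 1 (- z) ℕ.+ B 7 z) + + (B 0 (- w) ℕ.+ B 8 w)
      ≡⟨ cong₂ _+_ (cong₂ _+_ (cong₂ _+_ (diagonalHookSum-mirror 3 1 refl x) (diagonalHookSum-mirror 2 2 refl y))
                              (diagonalHookSum-mirror 1 3 refl z))
                   (diagonalHookSum-mirror 0 4 refl w) ⟩
    Q t
      ∎
    where
    open ≡-Reasoning
    B : ℕ → ℤ → ℕ
    B j v = diagonalHookSum (armsAt (j , v))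
    pair-up : ∀ b₀ b₁ b₂ b₃ b₅ b₆ b₇ b₈ →
      b₀ ℕ.+ (b₁ ℕ.+ (b₂ ℕ.+ (b₃ ℕ.+ (0 ℕ.+ (b₅ ℕ.+ (b₆ ℕ.+ (b₇ ℕ.+ (b₈ ℕ.+ 0))))))))
      ≡ (b₃ ℕ.+ b₅) ℕ.+ (b₂ ℕ.+ b₆) ℕ.+ (b₁ ℕ.+ b₇) ℕ.+ (b₀ ℕ.+ b₈)
    pair-up = ℕ-Solver.solve-∀

  q-double : ∀ h v → q (+ 2 * h) (+ 2 * v) ≡ + 4 * q h v
  q-double = expand
    where
    expand : ∀ h v → + 9 * ((+ 2 * v) * (+ 2 * v)) + + 2 * (+ 2 * h) * (+ 2 * v) ≡ + 4 * (+ 9 * (v * v) + + 2 * h * v)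
    expand = solve-∀

  q-odd : ∀ h v → q (+ 9 - + 2 * h) (- (+ 2 * v) + - + 1) ≡ + 4 * q h v + (+ 4 * h - + 9)
  q-odd = expand
    where
    expand : ∀ h v → + 9 * ((- (+ 2 * v) + - + 1) * (- (+ 2 * v) + - + 1)) + + 2 * (+ 9 - + 2 * h) * (- (+ 2 * v) + - + 1)
                     ≡ + 4 * (+ 9 * (v * v) + + 2 * h * v) + (+ 4 * h - + 9)
    expand = solve-∀

  Q-φ : ∀ t → Q (φ t) ≡ + 4 * Q t + + 10
  Q-φ ⟨ x , y , z , w ⟩ = begin
    q (+ 1) (- (+ 2 * w) + - + 1) + q (+ 2) (+ 2 * x) + q (+ 3) (- (+ 2 * z) + - + 1) + q (+ 4) (+ 2 * y)
      ≡⟨ cong₂ _+_ (cong₂ _+_ (cong₂ _+_ (q-odd (+ 4) w) (q-double (+ 1) x)) (q-odd (+ 3) z)) (q-double (+ 2) y) ⟩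
    (+ 4 * q (+ 4) w + + 7) + + 4 * q (+ 1) x + (+ 4 * q (+ 3) z + + 3) + + 4 * q (+ 2) y
      ≡⟨ regroup (q (+ 1) x) (q (+ 2) y) (q (+ 3) z) (q (+ 4) w) ⟩
    + 4 * Q ⟨ x , y , z , w ⟩ + + 10
      ∎
    where
    open ≡-Reasoning
    regroup : ∀ a b c d → (+ 4 * d + + 7) + + 4 * a + (+ 4 * c + + 3) + + 4 * b ≡ + 4 * (a + b + c + d) + + 10
    regroup = solve-∀

  SC9⇒Q≡ : ∀ {n} t → SC9 n t → Q t ≡ + n
  SC9⇒Q≡ t (size≡n , _) = trans (sym (size≡Q t)) (cong +_ size≡n)

  Q≡⇒SC9 : ∀ {n} t → Q t ≡ + n → SC9 n t
  Q≡⇒SC9 t Q≡n = ℤ.+-injective (trans (size≡Q t) Q≡n) , partitionOf-self-conjugate t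

module ImageOfφ where

  open import Defs
  open import Data.Nat as ℕ using (ℕ; suc; _<_)
  import Data.Nat.Tactic.RingSolver as ℕ-Solver
  open import Data.Nat.DivMod using (_%_; _/_; m≡m%n+[m/n]*n; [m+kn]%n≡m%n)
  open import Data.Integer using (ℤ; +_; -[1+_]; -_; _+_; _*_; _-_)
  import Data.Integer.Properties as ℤ
  open import Data.Integer.DivMod using (_%ℕ_; _/ℕ_; a≡a%ℕn+[a/ℕn]*n; n%ℕd<d)
  open import Data.Integer.Tactic.RingSolver using (solve-∀)
  open import Data.Fin using (Fin; toℕ; fromℕ<)
  open import Data.Fin.Properties using (all?; toℕ-fromℕ<)
  open import Data.Product using (Σ; _×_; _,_)
  open import Relation.Nullary.Decidable using (toWitness; _×-dec_; _→-dec_)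
  open import Relation.Binary.PropositionalEquality
  open import Algebra.Bundles using (AbelianGroup)
  open import Algebra.Properties.Group (AbelianGroup.group ℤ.+-0-abelianGroup) using () renaming (∙-cancelʳ to +-cancelʳ)
  open QuadraticSize using (q; Q; Q-φ; pos-+₄)

  double-injective : ∀ {a b} → + 2 * a ≡ + 2 * b → a ≡ b
  double-injective {a} {b} = ℤ.*-cancelˡ-≡ (+ 2) a b

  negOdd-injective : ∀ {a b} → - (+ 2 * a) + - + 1 ≡ - (+ 2 * b) + - + 1 → a ≡ b
  negOdd-injective {a} {b} e =
    double-injective (trans (recover a) (trans (cong (λ v → - (v + + 1)) e) (sym (recover b))))
    where
    recover : ∀ a → + 2 * a ≡ - ((- (+ 2 * a) + - + 1) + + 1)
    recover = solve-∀

  φ-injective : ∀ {t t′} → φ t ≡ φ t′ → t ≡ t′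
  φ-injective {⟨ x , y , z , w ⟩} {⟨ x′ , y′ , z′ , w′ ⟩} e
    with double-injective {x} {x′} (cong Tuple4.y e) | double-injective {y} {y′} (cong Tuple4.w e)
       | negOdd-injective {z} {z′} (cong Tuple4.z e) | negOdd-injective {w} {w′} (cong Tuple4.x e)
  ... | refl | refl | refl | refl = refl

  qℕ : ℕ → ℕ → ℕ
  qℕ h r = 9 ℕ.* (r ℕ.* r) ℕ.+ 2 ℕ.* h ℕ.* r

  q-pos : ∀ h r → q (+ h) (+ r) ≡ + qℕ h r
  q-pos h r = sym (trans (ℤ.pos-+ (9 ℕ.* (r ℕ.* r)) (2 ℕ.* h ℕ.* r))
    (cong₂ _+_ (trans (ℤ.pos-* 9 (r ℕ.* r)) (cong (+ 9 *_) (ℤ.pos-* r r)))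
               (trans (ℤ.pos-* (2 ℕ.* h) r) (cong (_* + r) (ℤ.pos-* 2 h)))))

  q-mod8 : ∀ h v → Σ ℤ λ P → q (+ h) v ≡ + 8 * P + + qℕ h (v %ℕ 4)
  q-mod8 h v = P , (begin
    q (+ h) v                   ≡⟨ cong (q (+ h)) (a≡a%ℕn+[a/ℕn]*n v 4) ⟩
    q (+ h) (+ r + m * + 4)     ≡⟨ split (+ h) m (+ r) ⟩
    + 8 * P + q (+ h) (+ r)     ≡⟨ cong (_+_ (+ 8 * P)) (q-pos h r) ⟩
    + 8 * P + + qℕ h r          ∎)
    where
    open ≡-Reasoning
    r = v %ℕ 4
    m = v /ℕ 4
    P = + 18 * (m * m) + + 9 * (m * + r) + + h * m
    split : ∀ H m R → + 9 * ((R + m * + 4) * (R + m * + 4)) + + 2 * H * (R + m * + 4)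
                      ≡ + 8 * (+ 18 * (m * m) + + 9 * (m * R) + H * m) + (+ 9 * (R * R) + + 2 * H * R)
    split = solve-∀

  residueSum : Tuple4 → ℕ
  residueSum ⟨ X , Y , Z , W ⟩ =
    qℕ 1 (X %ℕ 4) ℕ.+ qℕ 2 (Y %ℕ 4) ℕ.+ qℕ 3 (Z %ℕ 4) ℕ.+ qℕ 4 (W %ℕ 4)

  Q-mod8 : ∀ u → Σ ℤ λ P → Q u ≡ + 8 * P + + residueSum u
  Q-mod8 ⟨ X , Y , Z , W ⟩ with q-mod8 1 X | q-mod8 2 Y | q-mod8 3 Z | q-mod8 4 W
  ... | P₁ , e₁ | P₂ , e₂ | P₃ , e₃ | P₄ , e₄ = P₁ + P₂ + P₃ + P₄ , (begin
    q (+ 1) X + q (+ 2) Y + q (+ 3) Z + q (+ 4) W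
      ≡⟨ cong₂ _+_ (cong₂ _+_ (cong₂ _+_ e₁ e₂) e₃) e₄ ⟩
    (+ 8 * P₁ + + c₁) + (+ 8 * P₂ + + c₂) + (+ 8 * P₃ + + c₃) + (+ 8 * P₄ + + c₄)
      ≡⟨ regroup P₁ P₂ P₃ P₄ (+ c₁) (+ c₂) (+ c₃) (+ c₄) ⟩
    + 8 * (P₁ + P₂ + P₃ + P₄) + (+ c₁ + + c₂ + + c₃ + + c₄)
      ≡⟨ cong (_+_ (+ 8 * (P₁ + P₂ + P₃ + P₄))) (pos-+₄ c₁ c₂ c₃ c₄) ⟨
    + 8 * (P₁ + P₂ + P₃ + P₄) + + (c₁ ℕ.+ c₂ ℕ.+ c₃ ℕ.+ c₄)
      ∎)
    where
    open ≡-Reasoning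
    c₁ = qℕ 1 (X %ℕ 4)
    c₂ = qℕ 2 (Y %ℕ 4)
    c₃ = qℕ 3 (Z %ℕ 4)
    c₄ = qℕ 4 (W %ℕ 4)
    regroup : ∀ p₁ p₂ p₃ p₄ c₁ c₂ c₃ c₄ →
      (+ 8 * p₁ + c₁) + (+ 8 * p₂ + c₂) + (+ 8 * p₃ + c₃) + (+ 8 * p₄ + c₄)
      ≡ + 8 * (p₁ + p₂ + p₃ + p₄) + (c₁ + c₂ + c₃ + c₄)
    regroup = solve-∀

  %8-cong : ∀ A C P → + A ≡ + 8 * P + + C → A % 8 ≡ C % 8
  %8-cong A C (+ p) e = begin
    A % 8                  ≡⟨ cong (_% 8) (trans A≡ (comm p C)) ⟩
    (C ℕ.+ p ℕ.* 8) % 8    ≡⟨ [m+kn]%n≡m%n C p 8 ⟩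
    C % 8                  ∎
    where
    open ≡-Reasoning
    A≡ : A ≡ 8 ℕ.* p ℕ.+ C
    A≡ = ℤ.+-injective (trans e (cong (_+ + C) (sym (ℤ.pos-* 8 p))))
    comm : ∀ p C → 8 ℕ.* p ℕ.+ C ≡ C ℕ.+ p ℕ.* 8
    comm = ℕ-Solver.solve-∀
  %8-cong A C -[1+ p ] e = begin
    A % 8                        ≡⟨ [m+kn]%n≡m%n A (suc p) 8 ⟨
    (A ℕ.+ suc p ℕ.* 8) % 8      ≡⟨ cong (_% 8) C≡ ⟩
    C % 8                        ∎
    where
    open ≡-Reasoning
    cancel : ∀ K C → (+ 8 * (- K) + C) + K * + 8 ≡ C
    cancel = solve-∀
    C≡ : A ℕ.+ suc p ℕ.* 8 ≡ C
    C≡ = ℤ.+-injective (trans (trans (ℤ.pos-+ A (suc p ℕ.* 8)) (cong (_+_ (+ A)) (ℤ.pos-* (suc p) 8)))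
                              (trans (cong (_+ + suc p * + 8) e) (cancel (+ suc p) (+ C))))

  ParityPattern : ℕ → ℕ → ℕ → ℕ → Set
  ParityPattern a b c d = a % 2 ≡ 1 × b % 2 ≡ 0 × c % 2 ≡ 1 × d % 2 ≡ 0

  residues-parity : ∀ {a b c d} → a < 4 → b < 4 → c < 4 → d < 4 →
    (qℕ 1 a ℕ.+ qℕ 2 b ℕ.+ qℕ 3 c ℕ.+ qℕ 4 d) % 8 ≡ 2 → ParityPattern a b c d
  residues-parity a<4 b<4 c<4 d<4 =
    below 4 (λ i → below 4 (λ j → below 4 (λ k → below 4 (λ l → table i j k l) d<4) c<4) b<4) a<4
    where
    below : ∀ n {P : ℕ → Set} → (∀ (i : Fin n) → P (toℕ i)) → ∀ {m} → m < n → P m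
    below n {P} P-Fin m<n = subst P (toℕ-fromℕ< m<n) (P-Fin (fromℕ< m<n))
    Row : ℕ → ℕ → ℕ → ℕ → Set
    Row a b c d = (qℕ 1 a ℕ.+ qℕ 2 b ℕ.+ qℕ 3 c ℕ.+ qℕ 4 d) % 8 ≡ 2 → ParityPattern a b c d
    table : ∀ (i j k l : Fin 4) → Row (toℕ i) (toℕ j) (toℕ k) (toℕ l)
    table = toWitness {a? = all? λ i → all? λ j → all? λ k → all? λ l →
      let a = toℕ i ; b = toℕ j ; c = toℕ k ; d = toℕ l in
      ((qℕ 1 a ℕ.+ qℕ 2 b ℕ.+ qℕ 3 c ℕ.+ qℕ 4 d) % 8 ℕ.≟ 2) →-dec
      (a % 2 ℕ.≟ 1) ×-dec (b % 2 ℕ.≟ 0) ×-dec (c % 2 ℕ.≟ 1) ×-dec (d % 2 ℕ.≟ 0)} _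

  -- ⌊v/2⌋, written through v mod 4 so that parities can be read off the residue table.
  half : ℤ → ℤ
  half v = v /ℕ 4 * + 2 + + ((v %ℕ 4) / 2)

  halve : ∀ v → v ≡ + ((v %ℕ 4) % 2) + + 2 * half v
  halve v = begin
    v                                            ≡⟨ a≡a%ℕn+[a/ℕn]*n v 4 ⟩
    + r + m * + 4                                ≡⟨ cong (λ r → + r + m * + 4) (m≡m%n+[m/n]*n r 2) ⟩
    + (r % 2 ℕ.+ r / 2 ℕ.* 2) + m * + 4          ≡⟨ cong (_+ m * + 4) cast ⟩
    + (r % 2) + + (r / 2) * + 2 + m * + 4        ≡⟨ regroup (+ (r % 2)) (+ (r / 2)) m ⟩
    + (r % 2) + + 2 * (m * + 2 + + (r / 2))      ∎
    where
    open ≡-Reasoning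
    r = v %ℕ 4
    m = v /ℕ 4
    cast : + (r % 2 ℕ.+ r / 2 ℕ.* 2) ≡ + (r % 2) + + (r / 2) * + 2
    cast = trans (ℤ.pos-+ (r % 2) (r / 2 ℕ.* 2)) (cong (_+_ (+ (r % 2))) (ℤ.pos-* (r / 2) 2))
    regroup : ∀ e h m → e + h * + 2 + m * + 4 ≡ e + + 2 * (m * + 2 + h)
    regroup = solve-∀

  even⇒double : ∀ v → (v %ℕ 4) % 2 ≡ 0 → + 2 * half v ≡ v
  even⇒double v e = sym (trans (halve v) (trans (cong (λ e → + e + + 2 * half v) e) (ℤ.+-identityˡ (+ 2 * half v))))

  odd⇒negOdd : ∀ v → (v %ℕ 4) % 2 ≡ 1 → - (+ 2 * (- half v - + 1)) + - + 1 ≡ v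
  odd⇒negOdd v e = trans (flip (half v)) (sym (trans (halve v) (cong (λ e → + e + + 2 * half v) e)))
    where
    flip : ∀ h → - (+ 2 * (- h - + 1)) + - + 1 ≡ + 1 + + 2 * h
    flip = solve-∀

  ⟨⟩-cong : ∀ {a a′ b b′ c c′ d d′} → a ≡ a′ → b ≡ b′ → c ≡ c′ → d ≡ d′ →
            ⟨ a , b , c , d ⟩ ≡ ⟨ a′ , b′ , c′ , d′ ⟩
  ⟨⟩-cong refl refl refl refl = refl

  residueSum-2⇒image : ∀ u → residueSum u % 8 ≡ 2 → Σ Tuple4 λ t → φ t ≡ u
  residueSum-2⇒image ⟨ X , Y , Z , W ⟩ ≡2 =
    let X-odd , Y-even , Z-odd , W-even = residues-parity (n%ℕd<d X 4) (n%ℕd<d Y 4) (n%ℕd<d Z 4) (n%ℕd<d W 4) ≡2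
    in ⟨ half Y , half W , - half Z - + 1 , - half X - + 1 ⟩ ,
       ⟨⟩-cong (odd⇒negOdd X X-odd) (even⇒double Y Y-even) (odd⇒negOdd Z Z-odd) (even⇒double W W-even)

  Q≡8n+10⇒residueSum-2 : ∀ {n} u → Q u ≡ + (8 ℕ.* n ℕ.+ 10) → residueSum u % 8 ≡ 2
  Q≡8n+10⇒residueSum-2 {n} u Q≡ = let P , Q≡8P+C = Q-mod8 u in begin
    residueSum u % 8           ≡⟨ %8-cong (8 ℕ.* n ℕ.+ 10) (residueSum u) P (trans (sym Q≡) Q≡8P+C) ⟨
    (8 ℕ.* n ℕ.+ 10) % 8       ≡⟨ cong (_% 8) (comm n) ⟩
    (10 ℕ.+ n ℕ.* 8) % 8       ≡⟨ [m+kn]%n≡m%n 10 n 8 ⟩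
    2                          ∎
    where
    open ≡-Reasoning
    comm : ∀ n → 8 ℕ.* n ℕ.+ 10 ≡ 10 ℕ.+ n ℕ.* 8
    comm = ℕ-Solver.solve-∀

  Q-φ≡8n+10⇔Q≡2n : ∀ n t → (Q t ≡ + (2 ℕ.* n) → Q (φ t) ≡ + (8 ℕ.* n ℕ.+ 10))
                          × (Q (φ t) ≡ + (8 ℕ.* n ℕ.+ 10) → Q t ≡ + (2 ℕ.* n))
  Q-φ≡8n+10⇔Q≡2n n t =
    (λ Q≡ → trans (Q-φ t) (trans (cong (λ v → + 4 * v + + 10) Q≡) (sym 8n+10≡)))
    , (λ Qφ≡ → ℤ.*-cancelˡ-≡ (+ 4) (Q t) (+ (2 ℕ.* n))
                 (+-cancelʳ (+ 10) (+ 4 * Q t) (+ 4 * + (2 ℕ.* n)) (trans (sym (Q-φ t)) (trans Qφ≡ 8n+10≡))))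
    where
    8n+10≡ : + (8 ℕ.* n ℕ.+ 10) ≡ + 4 * + (2 ℕ.* n) + + 10
    8n+10≡ = cong (_+ + 10) (trans (ℤ.pos-* 8 n) (trans (assoc (+ n)) (cong (+ 4 *_) (sym (ℤ.pos-* 2 n)))))
      where
      assoc : ∀ n → + 8 * n ≡ + 4 * (+ 2 * n)
      assoc = solve-∀

open import Defs
open import Data.Nat using (ℕ; _+_; _*_)
open import Data.Product using (_×_; Σ; _,_; proj₁; proj₂)
open import Relation.Binary.PropositionalEquality using (_≡_; cong; trans)
open QuadraticSize using (Q; SC9⇒Q≡; Q≡⇒SC9)
open ImageOfφ using (φ-injective; Q-φ≡8n+10⇔Q≡2n; residueSum-2⇒image; Q≡8n+10⇒residueSum-2)

corollary5p16 : (n : ℕ) →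
    ((t : Tuple4) → SC9 (2 * n) t → SC9 (8 * n + 10) (φ t))
    × ((t t′ : Tuple4) → SC9 (2 * n) t → SC9 (2 * n) t′ → φ t ≡ φ t′ → t ≡ t′)
    × ((u : Tuple4) → SC9 (8 * n + 10) u → Σ Tuple4 (λ t → SC9 (2 * n) t × φ t ≡ u))
corollary5p16 n = maps-into , (λ _ _ _ _ → φ-injective) , onto
  where
  maps-into : (t : Tuple4) → SC9 (2 * n) t → SC9 (8 * n + 10) (φ t)
  maps-into t t∈ = Q≡⇒SC9 (φ t) (proj₁ (Q-φ≡8n+10⇔Q≡2n n t) (SC9⇒Q≡ t t∈))

  onto : (u : Tuple4) → SC9 (8 * n + 10) u → Σ Tuple4 (λ t → SC9 (2 * n) t × φ t ≡ u)
  onto u u∈ =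
    let t , φt≡u = residueSum-2⇒image u (Q≡8n+10⇒residueSum-2 {n} u (SC9⇒Q≡ u u∈))
    in t , Q≡⇒SC9 t (proj₂ (Q-φ≡8n+10⇔Q≡2n n t) (trans (cong Q φt≡u) (SC9⇒Q≡ u u∈))) , φt≡u
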